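{- Let $\Pi_1,\dots,\Pi_k$ be guess protocols, each using at most $l$ guesses and having communication cost at most $c$. Let $p(z_1,\dots,z_k)$ be a polynomial of degree $d$ with integer coefficients bounded in absolute value by $M$. Then there exists a guess protocol $\Pi$ such that $\mathrm{gap}_\Pi(x,y)=p\big(\mathrm{gap}_{\Pi_1}(x,y),\dots,\mathrm{gap}_{\Pi_k}(x,y)\big)$ for all inputs $(x,y)$, $\Pi$ uses at most $Ml^d(d+k)^{k+1}$ guesses, and $\Pi$ has communication cost at most $\lceil\log M+d\log l+(k+1)\log(d+k)\rceil+cd$.
   Context: A guess protocol $\Pi=(\Pi_1,\dots,\Pi_l)$ over $X\times Y$ is a finite sequence of deterministic two-party protocols with output in $\{0,1\}$; it uses $l$ guesses. $\mathrm{acc}_\Pi(x,y)=|\{i:\Pi_i(x,y)=1\}|$, $\mathrm{rej}_\Pi(x,y)=l-\mathrm{acc}_\Pi(x,y)$, and $\mathrm{gap}_\Pi=\mathrm{acc}_\Pi-\mathrm{rej}_\Pi$. The communication cost of $\Pi$ is $\lceil\log l\rceil+\max_iD(\Pi_i)$, with $D(\Pi_i)$ the worst-case communication of $\Pi_i$. Logarithms are base 2. -}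

module Defs where

open import Data.Bool using (Bool; true; false)
open import Data.Nat using (ℕ; zero; suc; _+_; _⊔_; _≤_)
open import Data.Nat.Logarithm using (⌈log₂_⌉)
open import Data.Integer as ℤ using (ℤ; +_; _-_)
open import Data.Fin using (Fin; toℕ)
import Data.Fin
open import Data.List using (List; []; _∷_; length; map; foldr)
open import Relation.Binary.PropositionalEquality using (_≢_)
open import Data.Vec.Functional using () renaming (_∷_ to _∷ᶠ_)

-- Deterministic two-party protocols (protocol trees) over X × Y with
-- output in {0,1} (Bool; true = 1).

data Protocol (X Y : Set) : Set where
  leaf  : Bool → Protocol X Y
  alice : (X → Bool) → Protocol X Y → Protocol X Y → Protocol X Y
  bob   : (Y → Bool) → Protocol X Y → Protocol X Y → Protocol X Y

module _ {X Y : Set} where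

  run : Protocol X Y → X → Y → Bool
  run (leaf b)      x y = b
  run (alice f l r) x y with f x
  ... | false = run l x y
  ... | true  = run r x y
  run (bob g l r)   x y with g y
  ... | false = run l x y
  ... | true  = run r x y

  D : Protocol X Y → ℕ
  D (leaf _)      = 0
  D (alice _ l r) = suc (D l ⊔ D r)
  D (bob _ l r)   = suc (D l ⊔ D r)

GuessProtocol : Set → Set → Set
GuessProtocol X Y = List (Protocol X Y)

module _ {X Y : Set} where

  guesses : GuessProtocol X Y → ℕ
  guesses = length

  acc : GuessProtocol X Y → X → Y → ℕ
  acc []       x y = 0
  acc (π ∷ Π) x y with run π x y
  ... | true  = suc (acc Π x y)
  ... | false = acc Π x y

  rej : GuessProtocol X Y → X → Y → ℕ
  rej []       x y = 0
  rej (π ∷ Π) x y with run π x y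
  ... | true  = rej Π x y
  ... | false = suc (rej Π x y)

  gap : GuessProtocol X Y → X → Y → ℤ
  gap Π x y = + acc Π x y - + rej Π x y

  cost : GuessProtocol X Y → ℕ
  cost Π = ⌈log₂ guesses Π ⌉ + foldr _⊔_ 0 (map D Π)

-- A polynomial with all exponents ≤ d is given by its coefficient
-- function on exponent vectors e : Fin k → Fin (suc d); the monomial
-- for e is  Π_i z_i ^ e_i .

Exponent : ℕ → ℕ → Set
Exponent k d = Fin k → Fin (suc d)

sumFin : (n : ℕ) → (Fin n → ℤ) → ℤ
sumFin zero    f = + 0
sumFin (suc n) f = f Data.Fin.zero ℤ.+ sumFin n (λ i → f (Data.Fin.suc i))

prodFin : (n : ℕ) → (Fin n → ℤ) → ℤ
prodFin zero    f = + 1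
prodFin (suc n) f = f Data.Fin.zero ℤ.* prodFin n (λ i → f (Data.Fin.suc i))

sumExp : (k m : ℕ) → ((Fin k → Fin m) → ℤ) → ℤ
sumExp zero    m f = f (λ ())
sumExp (suc k) m f = sumFin m (λ j → sumExp k m (λ e → f (j ∷ᶠ e)))

totalDeg : (k : ℕ) {m : ℕ} → (Fin k → Fin m) → ℕ
totalDeg zero    e = 0
totalDeg (suc k) e = toℕ (e Data.Fin.zero) + totalDeg k (λ i → e (Data.Fin.suc i))

DegreeAtMost : (k d : ℕ) → (Exponent k d → ℤ) → Set
DegreeAtMost k d p = ∀ e → p e ≢ + 0 → totalDeg k e ≤ d

CoeffsBoundedBy : (k d : ℕ) → (Exponent k d → ℤ) → ℕ → Set
CoeffsBoundedBy k d p M = ∀ e → ℤ.∣ p e ∣ ≤ M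

eval : (k d : ℕ) → (Exponent k d → ℤ) → (Fin k → ℤ) → ℤ
eval k d p z = sumExp k (suc d) (λ e → p e ℤ.* prodFin k (λ i → z i ℤ.^ toℕ (e i)))

module Submission where

-- The gap of a guess protocol is the sum of ±1 over its guesses. Flipping the
-- leaves of a protocol negates its sign, and grafting σ onto every leaf of π
-- (flipped under rejecting leaves) multiplies the signs of π and σ; so the list
-- of all graftings of a guess of A with a guess of B has gap gap A · gap B,
-- length |A| |B| and depth at most the sum of the depths. Monomials are
-- iterated products, a coefficient a is realised by |a| copies (flipped when
-- a < 0), and the polynomial by concatenating over all (d+1)^k exponent vectors.

open import Defs
open import Data.Nat using (ℕ; _+_; _*_; _^_; _≤_)
open import Data.Nat.Logarithm using (⌈log₂_⌉)
open import Data.Integer using (ℤ)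
open import Data.Fin using (Fin)
open import Data.Product using (Σ; _×_)
open import Relation.Binary.PropositionalEquality using (_≡_)

open import Data.Bool using (Bool; true; false; not)
open import Data.Nat as ℕ using (zero; suc; _⊔_; z≤n; s≤s; >-nonZero)
import Data.Nat.Properties as ℕ
open import Data.Nat.Logarithm using (⌈log₂⌉-mono-≤)
open import Data.Integer as ℤ using (+_; -[1+_]; 1ℤ; -1ℤ; -_)
import Data.Integer.Properties as ℤ
open import Data.Integer.Solver using (module +-*-Solver)
open +-*-Solver using (solve; con; _:+_; _:-_; _:=_)
open import Data.Fin using (toℕ) renaming (zero to fzero; suc to fsuc)
open import Data.List using (List; []; _∷_; length; map; foldr; _++_)
import Data.List.Properties as List
open import Data.List.Relation.Unary.All as All using (All; []; _∷_)
import Data.List.Relation.Unary.All.Properties as All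
open import Data.Vec.Functional using () renaming (_∷_ to _∷ᶠ_)
open import Data.Product using (_,_; proj₁; proj₂)
open import Function using (_∘_)
open import Relation.Binary.PropositionalEquality
  using (_≢_; refl; sym; trans; cong; cong₂; subst; subst₂; module ≡-Reasoning)
open import Relation.Nullary using (yes; no)

signed : Bool → ℤ
signed true  = 1ℤ
signed false = -1ℤ

module _ {X Y : Set} where

  open ≡-Reasoning

  flip : Protocol X Y → Protocol X Y
  flip (leaf b)      = leaf (not b)
  flip (alice f l r) = alice f (flip l) (flip r)
  flip (bob g l r)   = bob g (flip l) (flip r)

  run-flip : ∀ π x y → signed (run (flip π) x y) ≡ - signed (run π x y)
  run-flip (leaf true)   x y = refl
  run-flip (leaf false)  x y = refl
  run-flip (alice f l r) x y with f x
  ... | false = run-flip l x y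
  ... | true  = run-flip r x y
  run-flip (bob g l r)   x y with g y
  ... | false = run-flip l x y
  ... | true  = run-flip r x y

  D-flip : ∀ π → D (flip π) ≡ D π
  D-flip (leaf b)      = refl
  D-flip (alice f l r) = cong₂ (λ a b → suc (a ⊔ b)) (D-flip l) (D-flip r)
  D-flip (bob g l r)   = cong₂ (λ a b → suc (a ⊔ b)) (D-flip l) (D-flip r)

  graft : Protocol X Y → Protocol X Y → Protocol X Y
  graft (leaf true)   σ = σ
  graft (leaf false)  σ = flip σ
  graft (alice f l r) σ = alice f (graft l σ) (graft r σ)
  graft (bob g l r)   σ = bob g (graft l σ) (graft r σ)

  run-graft : ∀ π σ x y →
    signed (run (graft π σ) x y) ≡ signed (run π x y) ℤ.* signed (run σ x y)
  run-graft (leaf true)   σ x y = sym (ℤ.*-identityˡ _)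
  run-graft (leaf false)  σ x y = trans (run-flip σ x y) (sym (ℤ.-1*i≡-i _))
  run-graft (alice f l r) σ x y with f x
  ... | false = run-graft l σ x y
  ... | true  = run-graft r σ x y
  run-graft (bob g l r)   σ x y with g y
  ... | false = run-graft l σ x y
  ... | true  = run-graft r σ x y

  D-graft      : ∀ π σ → D (graft π σ) ≤ D π + D σ
  D-graft-node : ∀ l r σ → suc (D (graft l σ) ⊔ D (graft r σ)) ≤ suc (D l ⊔ D r) + D σ
  D-graft (leaf true)   σ = ℕ.≤-refl
  D-graft (leaf false)  σ = ℕ.≤-reflexive (D-flip σ)
  D-graft (alice f l r) σ = D-graft-node l r σ
  D-graft (bob g l r)   σ = D-graft-node l r σ

  D-graft-node l r σ = s≤s (ℕ.⊔-lub
    (ℕ.≤-trans (D-graft l σ) (ℕ.+-monoˡ-≤ (D σ) (ℕ.m≤m⊔n (D l) (D r))))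
    (ℕ.≤-trans (D-graft r σ) (ℕ.+-monoˡ-≤ (D σ) (ℕ.m≤n⊔m (D l) (D r)))))

  DepthAtMost : ℕ → GuessProtocol X Y → Set
  DepthAtMost b = All ((_≤ b) ∘ D)

  maxDepth : GuessProtocol X Y → ℕ
  maxDepth Π = foldr _⊔_ 0 (map D Π)

  maxDepth≤⇒depthAtMost : ∀ {b} Π → maxDepth Π ≤ b → DepthAtMost b Π
  maxDepth≤⇒depthAtMost Π h = All.map⁻ (List.foldr-forcesᵇ {P = _≤ _}
    (λ m n m⊔n≤b → ℕ.m⊔n≤o⇒m≤o m n m⊔n≤b , ℕ.m⊔n≤o⇒n≤o m n m⊔n≤b) 0 (map D Π) h)

  depthAtMost⇒maxDepth≤ : ∀ {b Π} → DepthAtMost b Π → maxDepth Π ≤ b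
  depthAtMost⇒maxDepth≤ {b} h = List.foldr-preservesᵇ {P = _≤ b} ℕ.⊔-lub z≤n (All.map⁺ h)

  depthAtMost-mono : ∀ {b b′ Π} → b ≤ b′ → DepthAtMost b Π → DepthAtMost b′ Π
  depthAtMost-mono b≤b′ = All.map (λ h → ℕ.≤-trans h b≤b′)

  gap-∷ : ∀ (π : Protocol X Y) Π x y → gap (π ∷ Π) x y ≡ signed (run π x y) ℤ.+ gap Π x y
  gap-∷ π Π x y with run π x y
  ... | true  = solve 2 (λ a r → (con 1ℤ :+ a) :- r := con 1ℤ :+ (a :- r)) refl
                  (+ acc Π x y) (+ rej Π x y)
  ... | false = solve 2 (λ a r → a :- (con 1ℤ :+ r) := con -1ℤ :+ (a :- r)) refl
                  (+ acc Π x y) (+ rej Π x y)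

  gap-++ : ∀ (A B : GuessProtocol X Y) x y → gap (A ++ B) x y ≡ gap A x y ℤ.+ gap B x y
  gap-++ []      B x y = sym (ℤ.+-identityˡ _)
  gap-++ (π ∷ A) B x y = begin
    gap (π ∷ A ++ B) x y                          ≡⟨ gap-∷ π (A ++ B) x y ⟩
    signed (run π x y) ℤ.+ gap (A ++ B) x y       ≡⟨ cong (ℤ._+_ (signed (run π x y))) (gap-++ A B x y) ⟩
    signed (run π x y) ℤ.+ (gap A x y ℤ.+ gap B x y) ≡⟨ ℤ.+-assoc (signed (run π x y)) (gap A x y) (gap B x y) ⟨
    (signed (run π x y) ℤ.+ gap A x y) ℤ.+ gap B x y ≡⟨ cong (ℤ._+ gap B x y) (gap-∷ π A x y) ⟨
    gap (π ∷ A) x y ℤ.+ gap B x y                 ∎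

  gap-map-flip : ∀ A x y → gap (map flip A) x y ≡ - gap A x y
  gap-map-flip []      x y = refl
  gap-map-flip (π ∷ A) x y = begin
    gap (flip π ∷ map flip A) x y                       ≡⟨ gap-∷ (flip π) (map flip A) x y ⟩
    signed (run (flip π) x y) ℤ.+ gap (map flip A) x y  ≡⟨ cong₂ ℤ._+_ (run-flip π x y) (gap-map-flip A x y) ⟩
    - signed (run π x y) ℤ.+ - gap A x y                ≡⟨ ℤ.neg-distrib-+ (signed (run π x y)) (gap A x y) ⟨
    - (signed (run π x y) ℤ.+ gap A x y)                ≡⟨ cong -_ (gap-∷ π A x y) ⟨
    - gap (π ∷ A) x y                                   ∎

  gap-map-graft : ∀ π B x y → gap (map (graft π) B) x y ≡ signed (run π x y) ℤ.* gap B x y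
  gap-map-graft π []      x y = sym (ℤ.*-zeroʳ (signed (run π x y)))
  gap-map-graft π (σ ∷ B) x y = begin
    gap (graft π σ ∷ map (graft π) B) x y                  ≡⟨ gap-∷ (graft π σ) _ x y ⟩
    signed (run (graft π σ) x y) ℤ.+ gap (map (graft π) B) x y
      ≡⟨ cong₂ ℤ._+_ (run-graft π σ x y) (gap-map-graft π B x y) ⟩
    s ℤ.* signed (run σ x y) ℤ.+ s ℤ.* gap B x y           ≡⟨ ℤ.*-distribˡ-+ s (signed (run σ x y)) (gap B x y) ⟨
    s ℤ.* (signed (run σ x y) ℤ.+ gap B x y)               ≡⟨ cong (s ℤ.*_) (gap-∷ σ B x y) ⟨
    s ℤ.* gap (σ ∷ B) x y                                  ∎
    where s = signed (run π x y)

  _⊗_ : GuessProtocol X Y → GuessProtocol X Y → GuessProtocol X Y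
  []      ⊗ B = []
  (π ∷ A) ⊗ B = map (graft π) B ++ (A ⊗ B)

  gap-⊗ : ∀ A B x y → gap (A ⊗ B) x y ≡ gap A x y ℤ.* gap B x y
  gap-⊗ []      B x y = sym (ℤ.*-zeroˡ (gap B x y))
  gap-⊗ (π ∷ A) B x y = begin
    gap (map (graft π) B ++ (A ⊗ B)) x y                       ≡⟨ gap-++ (map (graft π) B) (A ⊗ B) x y ⟩
    gap (map (graft π) B) x y ℤ.+ gap (A ⊗ B) x y              ≡⟨ cong₂ ℤ._+_ (gap-map-graft π B x y) (gap-⊗ A B x y) ⟩
    signed (run π x y) ℤ.* gap B x y ℤ.+ gap A x y ℤ.* gap B x y ≡⟨ ℤ.*-distribʳ-+ (gap B x y) (signed (run π x y)) (gap A x y) ⟨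
    (signed (run π x y) ℤ.+ gap A x y) ℤ.* gap B x y           ≡⟨ cong (ℤ._* gap B x y) (gap-∷ π A x y) ⟨
    gap (π ∷ A) x y ℤ.* gap B x y                              ∎

  length-⊗ : ∀ A B → length (A ⊗ B) ≡ length A * length B
  length-⊗ []      B = refl
  length-⊗ (π ∷ A) B = trans (List.length-++ (map (graft π) B))
    (cong₂ _+_ (List.length-map (graft π) B) (length-⊗ A B))

  depthAtMost-⊗ : ∀ {a b A B} → DepthAtMost a A → DepthAtMost b B → DepthAtMost (a + b) (A ⊗ B)
  depthAtMost-⊗ []               hB = []
  depthAtMost-⊗ (_∷_ {π} hπ hA) hB = All.++⁺
    (All.map⁺ (All.map (λ {σ} hσ → ℕ.≤-trans (D-graft π σ) (ℕ.+-mono-≤ hπ hσ)) hB))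
    (depthAtMost-⊗ hA hB)

  accept : GuessProtocol X Y
  accept = leaf true ∷ []

  _^⊗_ : GuessProtocol X Y → ℕ → GuessProtocol X Y
  A ^⊗ zero  = accept
  A ^⊗ suc n = A ⊗ (A ^⊗ n)

  gap-^⊗ : ∀ A n x y → gap (A ^⊗ n) x y ≡ gap A x y ℤ.^ n
  gap-^⊗ A zero    x y = refl
  gap-^⊗ A (suc n) x y = trans (gap-⊗ A (A ^⊗ n) x y) (cong (gap A x y ℤ.*_) (gap-^⊗ A n x y))

  length-^⊗ : ∀ {l} A n → length A ≤ l → length (A ^⊗ n) ≤ l ^ n
  length-^⊗ A zero    h = ℕ.≤-refl
  length-^⊗ A (suc n) h =
    ℕ.≤-trans (ℕ.≤-reflexive (length-⊗ A (A ^⊗ n))) (ℕ.*-mono-≤ h (length-^⊗ A n h))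

  depthAtMost-^⊗ : ∀ {c} A n → DepthAtMost c A → DepthAtMost (n * c) (A ^⊗ n)
  depthAtMost-^⊗ A zero    h = z≤n ∷ []
  depthAtMost-^⊗ A (suc n) h = depthAtMost-⊗ h (depthAtMost-^⊗ A n h)

  monomial : (k : ℕ) {m : ℕ} → (Fin k → Fin m) → (Fin k → GuessProtocol X Y) → GuessProtocol X Y
  monomial zero    e Πs = accept
  monomial (suc k) e Πs = (Πs fzero ^⊗ toℕ (e fzero)) ⊗ monomial k (e ∘ fsuc) (Πs ∘ fsuc)

  gap-monomial : ∀ k {m} (e : Fin k → Fin m) Πs x y →
    gap (monomial k e Πs) x y ≡ prodFin k (λ i → gap (Πs i) x y ℤ.^ toℕ (e i))
  gap-monomial zero    e Πs x y = refl
  gap-monomial (suc k) e Πs x y =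
    trans (gap-⊗ (Πs fzero ^⊗ toℕ (e fzero)) _ x y)
          (cong₂ ℤ._*_ (gap-^⊗ (Πs fzero) (toℕ (e fzero)) x y) (gap-monomial k (e ∘ fsuc) (Πs ∘ fsuc) x y))

  length-monomial : ∀ {l} k {m} (e : Fin k → Fin m) Πs → (∀ i → length (Πs i) ≤ l) →
    length (monomial k e Πs) ≤ l ^ totalDeg k e
  length-monomial         zero    e Πs h = ℕ.≤-refl
  length-monomial {l = l} (suc k) e Πs h =
    subst₂ _≤_ (sym (length-⊗ (Πs fzero ^⊗ toℕ (e fzero)) (monomial k (e ∘ fsuc) (Πs ∘ fsuc))))
               (sym (ℕ.^-distribˡ-+-* l (toℕ (e fzero)) (totalDeg k (e ∘ fsuc))))
      (ℕ.*-mono-≤ (length-^⊗ (Πs fzero) (toℕ (e fzero)) (h fzero))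
                  (length-monomial k (e ∘ fsuc) (Πs ∘ fsuc) (h ∘ fsuc)))

  depthAtMost-monomial : ∀ {c} k {m} (e : Fin k → Fin m) Πs → (∀ i → DepthAtMost c (Πs i)) →
    DepthAtMost (totalDeg k e * c) (monomial k e Πs)
  depthAtMost-monomial     zero    e Πs h = z≤n ∷ []
  depthAtMost-monomial {c} (suc k) e Πs h =
    subst (λ b → DepthAtMost b (monomial (suc k) e Πs)) (sym (ℕ.*-distribʳ-+ c (toℕ (e fzero)) (totalDeg k (e ∘ fsuc))))
      (depthAtMost-⊗ (depthAtMost-^⊗ (Πs fzero) (toℕ (e fzero)) (h fzero))
                     (depthAtMost-monomial k (e ∘ fsuc) (Πs ∘ fsuc) (h ∘ fsuc)))

  copies : ℕ → GuessProtocol X Y → GuessProtocol X Y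
  copies zero    A = []
  copies (suc n) A = A ++ copies n A

  gap-copies : ∀ n A x y → gap (copies n A) x y ≡ + n ℤ.* gap A x y
  gap-copies zero    A x y = sym (ℤ.*-zeroˡ (gap A x y))
  gap-copies (suc n) A x y = begin
    gap (A ++ copies n A) x y              ≡⟨ gap-++ A (copies n A) x y ⟩
    gap A x y ℤ.+ gap (copies n A) x y     ≡⟨ cong₂ ℤ._+_ (sym (ℤ.*-identityˡ (gap A x y))) (gap-copies n A x y) ⟩
    1ℤ ℤ.* gap A x y ℤ.+ + n ℤ.* gap A x y ≡⟨ ℤ.*-distribʳ-+ (gap A x y) 1ℤ (+ n) ⟨
    + suc n ℤ.* gap A x y                  ∎

  length-copies : ∀ n A → length (copies n A) ≡ n * length A
  length-copies zero    A = refl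
  length-copies (suc n) A = trans (List.length-++ A) (cong (_+_ (length A)) (length-copies n A))

  depthAtMost-copies : ∀ {b} n {A} → DepthAtMost b A → DepthAtMost b (copies n A)
  depthAtMost-copies zero    h = []
  depthAtMost-copies (suc n) h = All.++⁺ h (depthAtMost-copies n h)

  scale : ℤ → GuessProtocol X Y → GuessProtocol X Y
  scale (+ n)    A = copies n A
  scale -[1+ n ] A = map flip (copies (suc n) A)

  gap-scale : ∀ a A x y → gap (scale a A) x y ≡ a ℤ.* gap A x y
  gap-scale (+ n)    A x y = gap-copies n A x y
  gap-scale -[1+ n ] A x y = begin
    gap (map flip (copies (suc n) A)) x y ≡⟨ gap-map-flip (copies (suc n) A) x y ⟩
    - gap (copies (suc n) A) x y          ≡⟨ cong -_ (gap-copies (suc n) A x y) ⟩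
    - (+ suc n ℤ.* gap A x y)             ≡⟨ ℤ.neg-distribˡ-* (+ suc n) (gap A x y) ⟩
    -[1+ n ] ℤ.* gap A x y                ∎

  length-scale : ∀ a A → length (scale a A) ≡ ℤ.∣ a ∣ * length A
  length-scale (+ n)    A = length-copies n A
  length-scale -[1+ n ] A = trans (List.length-map flip (copies (suc n) A)) (length-copies (suc n) A)

  depthAtMost-scale : ∀ {b} a {A} → DepthAtMost b A → DepthAtMost b (scale a A)
  depthAtMost-scale (+ n)    h = depthAtMost-copies n h
  depthAtMost-scale -[1+ n ] h =
    All.map⁺ (All.map (λ {π} hπ → ℕ.≤-trans (ℕ.≤-reflexive (D-flip π)) hπ) (depthAtMost-copies (suc n) h))

  concatFin : (n : ℕ) → (Fin n → GuessProtocol X Y) → GuessProtocol X Y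
  concatFin zero    F = []
  concatFin (suc n) F = F fzero ++ concatFin n (F ∘ fsuc)

  concatExp : (k m : ℕ) → ((Fin k → Fin m) → GuessProtocol X Y) → GuessProtocol X Y
  concatExp zero    m F = F (λ ())
  concatExp (suc k) m F = concatFin m (λ j → concatExp k m (F ∘ (j ∷ᶠ_)))

  gap-concatFin : ∀ n F (G : Fin n → ℤ) x y → (∀ j → gap (F j) x y ≡ G j) →
    gap (concatFin n F) x y ≡ sumFin n G
  gap-concatFin zero    F G x y h = refl
  gap-concatFin (suc n) F G x y h = trans (gap-++ (F fzero) _ x y)
    (cong₂ ℤ._+_ (h fzero) (gap-concatFin n (F ∘ fsuc) (G ∘ fsuc) x y (h ∘ fsuc)))

  gap-concatExp : ∀ k m F (G : (Fin k → Fin m) → ℤ) x y → (∀ e → gap (F e) x y ≡ G e) →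
    gap (concatExp k m F) x y ≡ sumExp k m G
  gap-concatExp zero    m F G x y h = h _
  gap-concatExp (suc k) m F G x y h =
    gap-concatFin m (λ j → concatExp k m (F ∘ (j ∷ᶠ_))) (λ j → sumExp k m (G ∘ (j ∷ᶠ_))) x y
    (λ j → gap-concatExp k m (F ∘ (j ∷ᶠ_)) (G ∘ (j ∷ᶠ_)) x y (h ∘ (j ∷ᶠ_)))

  length-concatFin : ∀ {B} n F → (∀ j → length (F j) ≤ B) → length (concatFin n F) ≤ n * B
  length-concatFin zero    F h = z≤n
  length-concatFin (suc n) F h = ℕ.≤-trans (ℕ.≤-reflexive (List.length-++ (F fzero)))
    (ℕ.+-mono-≤ (h fzero) (length-concatFin n (F ∘ fsuc) (h ∘ fsuc)))

  length-concatExp : ∀ {B} k m F → (∀ e → length (F e) ≤ B) → length (concatExp k m F) ≤ m ^ k * B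
  length-concatExp {B} zero    m F h = ℕ.≤-trans (h (λ ())) (ℕ.≤-reflexive (sym (ℕ.+-identityʳ B)))
  length-concatExp {B} (suc k) m F h = ℕ.≤-trans
    (length-concatFin m (λ j → concatExp k m (F ∘ (j ∷ᶠ_))) (λ j → length-concatExp k m (F ∘ (j ∷ᶠ_)) (h ∘ (j ∷ᶠ_))))
    (ℕ.≤-reflexive (sym (ℕ.*-assoc m (m ^ k) B)))

  depthAtMost-concatFin : ∀ {b} n F → (∀ j → DepthAtMost b (F j)) → DepthAtMost b (concatFin n F)
  depthAtMost-concatFin zero    F h = []
  depthAtMost-concatFin (suc n) F h = All.++⁺ (h fzero) (depthAtMost-concatFin n (F ∘ fsuc) (h ∘ fsuc))

  depthAtMost-concatExp : ∀ {b} k m F → (∀ e → DepthAtMost b (F e)) → DepthAtMost b (concatExp k m F)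
  depthAtMost-concatExp zero    m F h = h _
  depthAtMost-concatExp (suc k) m F h =
    depthAtMost-concatFin m _ (λ j → depthAtMost-concatExp k m (F ∘ (j ∷ᶠ_)) (h ∘ (j ∷ᶠ_)))

-- The bounds on the monomial are needed only when a ≢ 0, since scale 0 A = [];
-- the degree hypothesis constrains only monomials with nonzero coefficient.
length-depth-scale : ∀ {X Y : Set} a (A : GuessProtocol X Y) {M L b} → ℤ.∣ a ∣ ≤ M →
  (a ≢ + 0 → length A ≤ L × DepthAtMost b A) →
  length (scale a A) ≤ M * L × DepthAtMost b (scale a A)
length-depth-scale a A ∣a∣≤M h with a ℤ.≟ + 0
... | yes refl = z≤n , []
... | no a≢0   = ℕ.≤-trans (ℕ.≤-reflexive (length-scale a A)) (ℕ.*-mono-≤ ∣a∣≤M (proj₁ (h a≢0)))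
               , depthAtMost-scale a (proj₂ (h a≢0))

exponentCount≤ : ∀ d k → 1 ≤ d + k → suc d ^ k ≤ (d + k) ^ (k + 1)
exponentCount≤ d zero    h = subst (1 ≤_) (sym (ℕ.*-identityʳ (d + 0))) h
exponentCount≤ d (suc k) h = begin
  suc d ^ suc k           ≤⟨ ℕ.^-monoˡ-≤ (suc k) suc-d≤d+suc-k ⟩
  (d + suc k) ^ suc k     ≤⟨ ℕ.^-monoʳ-≤ (d + suc k) {{>-nonZero h}} (ℕ.m≤m+n (suc k) 1) ⟩
  (d + suc k) ^ (suc k + 1) ∎
  where
  open ℕ.≤-Reasoning
  suc-d≤d+suc-k : suc d ≤ d + suc k
  suc-d≤d+suc-k = subst (suc d ≤_) (sym (ℕ.+-suc d k)) (s≤s (ℕ.m≤m+n d k))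

lemma2 : {X Y : Set} (k l c d M : ℕ)
         → 1 ≤ l → 1 ≤ d + k
         → (Πs : Fin k → GuessProtocol X Y)
         → (∀ i → guesses (Πs i) ≤ l)
         → (∀ i → cost (Πs i) ≤ c)
         → (p : Exponent k d → ℤ)
         → DegreeAtMost k d p
         → CoeffsBoundedBy k d p M
         → Σ (GuessProtocol X Y) λ Π
             → (∀ x y → gap Π x y ≡ eval k d p (λ i → gap (Πs i) x y))
             × guesses Π ≤ M * l ^ d * (d + k) ^ (k + 1)
             × cost Π ≤ ⌈log₂ (M * l ^ d * (d + k) ^ (k + 1)) ⌉ + c * d
lemma2 {X} {Y} k l c d M 1≤l 1≤d+k Πs guesses≤l cost≤c p deg≤d ∣p∣≤M =
  Π , gap-Π , guesses-Π , ℕ.+-mono-≤ (⌈log₂⌉-mono-≤ guesses-Π) depth-Π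
  where
  term : Exponent k d → GuessProtocol X Y
  term e = scale (p e) (monomial k e Πs)

  Π : GuessProtocol X Y
  Π = concatExp k (suc d) term

  gap-Π : ∀ x y → gap Π x y ≡ eval k d p (λ i → gap (Πs i) x y)
  gap-Π x y = gap-concatExp k (suc d) term _ x y
    (λ e → trans (gap-scale (p e) _ x y) (cong (p e ℤ.*_) (gap-monomial k e Πs x y)))

  depth≤c : ∀ i → DepthAtMost c (Πs i)
  depth≤c i = maxDepth≤⇒depthAtMost (Πs i) (ℕ.≤-trans (ℕ.m≤n+m (maxDepth (Πs i)) ⌈log₂ guesses (Πs i) ⌉) (cost≤c i))

  term-bounds : ∀ e → length (term e) ≤ M * l ^ d × DepthAtMost (c * d) (term e)
  term-bounds e = length-depth-scale (p e) (monomial k e Πs) (∣p∣≤M e) λ pe≢0 →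
      ℕ.≤-trans (length-monomial k e Πs guesses≤l) (ℕ.^-monoʳ-≤ l {{>-nonZero 1≤l}} (deg≤d e pe≢0))
    , depthAtMost-mono (ℕ.≤-trans (ℕ.*-monoˡ-≤ c (deg≤d e pe≢0)) (ℕ.≤-reflexive (ℕ.*-comm d c)))
                       (depthAtMost-monomial k e Πs depth≤c)

  guesses-Π : guesses Π ≤ M * l ^ d * (d + k) ^ (k + 1)
  guesses-Π = ℕ.≤-trans (length-concatExp k (suc d) term (proj₁ ∘ term-bounds))
    (ℕ.≤-trans (ℕ.*-monoˡ-≤ (M * l ^ d) (exponentCount≤ d k 1≤d+k))
               (ℕ.≤-reflexive (ℕ.*-comm ((d + k) ^ (k + 1)) (M * l ^ d))))

  depth-Π : maxDepth Π ≤ c * d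
  depth-Π = depthAtMost⇒maxDepth≤ (depthAtMost-concatExp k (suc d) term (proj₂ ∘ term-bounds))
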